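{- Let $(\alpha,\beta)$ be a TF-automorphism of a graph $\Gamma$. Then: (a) both $\alpha$ and $\beta$ are automorphisms of $S(\Gamma)$; (b) if $\Gamma$ is connected and bipartite, then $\alpha$ and $\beta$ either both stabilize each of the two bipartite sets or both interchange the two bipartite sets.
   Context: All graphs are finite, undirected, without multiple edges, but possibly with loops; $A(\Gamma)$ is the set of arcs (ordered pairs of adjacent vertices). A two-fold automorphism (TF-automorphism) of $\Gamma$ is a pair $(\alpha,\beta)$ of permutations of $V(\Gamma)$ such that for all $s,t\in V(\Gamma)$, $(s,t)\in A(\Gamma)\iff(s^\alpha,t^\beta)\in A(\Gamma)$. For a graph $\Gamma$, $B(\Gamma)$ is the graph on $V(\Gamma)$ whose edges are the pairs $\{u,v\}$ with $u\neq v$ and $N_\Gamma(u)\cap N_\Gamma(v)\neq\emptyset$. An edge $\{u,v\}$ of $B(\Gamma)$ is dispensable if there exists $w\in V(\Gamma)$ such that both (i) $N_\Gamma(u)\cap N_\Gamma(v)\subsetneq N_\Gamma(u)\cap N_\Gamma(w)$ or $N_\Gamma(u)\subsetneq N_\Gamma(w)\subsetneq N_\Gamma(v)$, and (ii) $N_\Gamma(v)\cap N_\Gamma(u)\subsetneq N_\Gamma(v)\cap N_\Gamma(w)$ or $N_\Gamma(v)\subsetneq N_\Gamma(w)\subsetneq N_\Gamma(u)$. The Cartesian skeleton $S(\Gamma)$ is obtained from $B(\Gamma)$ by deleting all dispensable edges. -}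

module Defs where

open import Data.Nat using (ℕ; zero; suc)
open import Data.Fin using (Fin)
open import Data.Bool using (Bool; true; false; not)
open import Data.Product using (_×_; _,_; ∃; ∃-syntax)
open import Data.Sum using (_⊎_)
open import Relation.Nullary using (¬_)
open import Relation.Binary.PropositionalEquality using (_≡_; _≢_)
open import Function.Bundles using (_⇔_)
open import Data.Fin.Permutation using (Permutation′; _⟨$⟩ʳ_)

-- A finite graph (undirected, no multi-edges, loops allowed) on vertex set Fin n,
-- given by a symmetric Boolean adjacency function.
record Graph (n : ℕ) : Set where
  field
    adj : Fin n → Fin n → Bool
    adj-sym : ∀ u v → adj u v ≡ adj v u
open Graph public

Arc : ∀ {n} → Graph n → Fin n → Fin n → Set
Arc Γ s t = adj Γ s t ≡ true

Pred : ℕ → Set₁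
Pred n = Fin n → Set

_⊆_ : ∀ {n} → Pred n → Pred n → Set
P ⊆ Q = ∀ x → P x → Q x

_⊊_ : ∀ {n} → Pred n → Pred n → Set
P ⊊ Q = (P ⊆ Q) × (∃[ x ] (Q x × ¬ P x))

_∩_ : ∀ {n} → Pred n → Pred n → Pred n
(P ∩ Q) x = P x × Q x

N : ∀ {n} → Graph n → Fin n → Pred n
N Γ u x = Arc Γ u x

IsTFAut : ∀ {n} → Graph n → Permutation′ n → Permutation′ n → Set
IsTFAut Γ α β = ∀ s t → Arc Γ s t ⇔ Arc Γ (α ⟨$⟩ʳ s) (β ⟨$⟩ʳ t)

BEdge : ∀ {n} → Graph n → Fin n → Fin n → Set
BEdge Γ u v = (u ≢ v) × (∃[ x ] ((N Γ u ∩ N Γ v) x))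

Dispensable : ∀ {n} → Graph n → Fin n → Fin n → Set
Dispensable Γ u v = ∃[ w ]
  ( (((N Γ u ∩ N Γ v) ⊊ (N Γ u ∩ N Γ w)) ⊎ ((N Γ u ⊊ N Γ w) × (N Γ w ⊊ N Γ v)))
  × (((N Γ v ∩ N Γ u) ⊊ (N Γ v ∩ N Γ w)) ⊎ ((N Γ v ⊊ N Γ w) × (N Γ w ⊊ N Γ u))) )

SEdge : ∀ {n} → Graph n → Fin n → Fin n → Set
SEdge Γ u v = BEdge Γ u v × ¬ Dispensable Γ u v

IsAutS : ∀ {n} → Graph n → Permutation′ n → Set
IsAutS Γ α = ∀ u v → SEdge Γ u v ⇔ SEdge Γ (α ⟨$⟩ʳ u) (α ⟨$⟩ʳ v)

data Walk {n} (Γ : Graph n) : Fin n → Fin n → Set where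
  here : ∀ {u} → Walk Γ u u
  step : ∀ {u v w} → Arc Γ u v → Walk Γ v w → Walk Γ u w

Connected : ∀ {n} → Graph n → Set
Connected Γ = ∀ u v → Walk Γ u v

-- A bipartition of Γ given by a proper 2-colouring c (parts c⁻¹(false), c⁻¹(true))
IsBipartition : ∀ {n} → Graph n → (Fin n → Bool) → Set
IsBipartition Γ c = ∀ u v → Arc Γ u v → c u ≢ c v

Stabilizes : ∀ {n} → (Fin n → Bool) → Permutation′ n → Set
Stabilizes c α = ∀ v → c (α ⟨$⟩ʳ v) ≡ c v

Interchanges : ∀ {n} → (Fin n → Bool) → Permutation′ n → Set
Interchanges c α = ∀ v → c (α ⟨$⟩ʳ v) ≡ not (c v)

-- A TF-automorphism (α, β) carries each neighbourhood N(u) onto N(α u) via β, and both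
-- B(Γ) and dispensability are expressed through intersections and strict inclusions of
-- neighbourhoods, which such a transport preserves; applying this to (α⁻¹, β⁻¹) and to
-- (β, α) gives (a).
-- For (b), let sπ(u) = c(π u) xor c(u). An arc (u, v) and its image arc (α u, β v) both
-- cross the bipartition, so sα(u) = sβ(v): the pair (sα, sβ) is swapped along every arc,
-- hence along a walk it is swapped exactly when the colour changes. Comparing r with
-- α⁻¹ r and with β⁻¹ r forces sα(r) = sβ(r), and connectivity then makes both shifts
-- the same constant.
module Submission where

open import Defs
open import Data.Nat using (ℕ; zero; suc)
open import Data.Bool using (Bool; true; false; not; _xor_)
open import Data.Bool.Properties
  using (¬-not; xor-same; xor-annihilates-not; not-distribˡ-xor)
open import Data.Fin as Fin using (Fin)
open import Data.Fin.Permutation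
  using (Permutation′; _⟨$⟩ʳ_; _⟨$⟩ˡ_; inverseˡ; inverseʳ; flip)
open import Data.Product using (_×_; _,_; proj₁; proj₂; swap)
open import Data.Product.Function.NonDependent.Propositional using (_×-⇔_)
open import Data.Sum using (_⊎_; inj₁; inj₂)
import Data.Sum as Sum
open import Function using (_∘_)
open import Function.Bundles using (_⇔_; mk⇔; Equivalence; Injection)
open import Function.Properties.Equivalence using ()
  renaming (sym to ⇔-sym; trans to ⇔-trans)
open import Function.Properties.Inverse using (↔⇒↣)
open import Function.Related.TypeIsomorphisms using (¬-cong-⇔)
open import Relation.Binary.PropositionalEquality
  using (_≡_; refl; sym; trans; cong; cong₂; subst; subst₂; module ≡-Reasoning)
open Equivalence using (to; from)

module _ {n : ℕ} where

  infix 4 _↦[_]_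

  record _↦[_]_ (P : Pred n) (β : Permutation′ n) (Q : Pred n) : Set where
    constructor transport
    field
      ⇔-image : ∀ x → P x ⇔ Q (β ⟨$⟩ʳ x)
  open _↦[_]_ public

  module _ {β : Permutation′ n} {P P′ Q Q′ : Pred n}
           (P↦P′ : P ↦[ β ] P′) (Q↦Q′ : Q ↦[ β ] Q′) where

    ↦-∩ : (P ∩ Q) ↦[ β ] (P′ ∩ Q′)
    ↦-∩ = transport λ x → ⇔-image P↦P′ x ×-⇔ ⇔-image Q↦Q′ x

    ↦-⊆ : P ⊆ Q → P′ ⊆ Q′
    ↦-⊆ P⊆Q y P′y = subst Q′ (inverseʳ β) (to (⇔-image Q↦Q′ x) (P⊆Q x Px))
      where
      x = β ⟨$⟩ˡ y
      Px : P x
      Px = from (⇔-image P↦P′ x) (subst P′ (sym (inverseʳ β)) P′y)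

    ↦-⊊ : P ⊊ Q → P′ ⊊ Q′
    ↦-⊊ (P⊆Q , x , Qx , ¬Px) =
      ↦-⊆ P⊆Q , β ⟨$⟩ʳ x , to (⇔-image Q↦Q′ x) Qx , ¬Px ∘ from (⇔-image P↦P′ x)

  -- Condition (i) for the edge {u,v} and the witness w, read on U = N(u), V = N(v),
  -- W = N(w); condition (ii) is Dispenses V U W.
  Dispenses : Pred n → Pred n → Pred n → Set
  Dispenses U V W = ((U ∩ V) ⊊ (U ∩ W)) ⊎ ((U ⊊ W) × (W ⊊ V))

  ↦-Dispenses : ∀ {β U U′ V V′ W W′} → U ↦[ β ] U′ → V ↦[ β ] V′ → W ↦[ β ] W′ →
                Dispenses U V W → Dispenses U′ V′ W′
  ↦-Dispenses U↦ V↦ W↦ = Sum.map (↦-⊊ (↦-∩ U↦ V↦) (↦-∩ U↦ W↦))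
                                  (λ (U⊊W , W⊊V) → ↦-⊊ U↦ W↦ U⊊W , ↦-⊊ W↦ V↦ W⊊V)

module _ {n : ℕ} (Γ : Graph n) where

  arc-sym : ∀ {s t} → Arc Γ s t → Arc Γ t s
  arc-sym {s} {t} = trans (adj-sym Γ t s)

  arc-sym-⇔ : ∀ {s t} → Arc Γ s t ⇔ Arc Γ t s
  arc-sym-⇔ = mk⇔ arc-sym arc-sym

  tfAut-swap : ∀ α β → IsTFAut Γ α β → IsTFAut Γ β α
  tfAut-swap α β tf s t = ⇔-trans arc-sym-⇔ (⇔-trans (tf t s) arc-sym-⇔)

  tfAut-inverse : ∀ α β → IsTFAut Γ α β → IsTFAut Γ (flip α) (flip β)
  tfAut-inverse α β tf s t =
    ⇔-sym (subst₂ (λ s′ t′ → Arc Γ (α ⟨$⟩ˡ s) (β ⟨$⟩ˡ t) ⇔ Arc Γ s′ t′)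
                  (inverseʳ α) (inverseʳ β) (tf (α ⟨$⟩ˡ s) (β ⟨$⟩ˡ t)))

  N-↦ : ∀ α β → IsTFAut Γ α β → ∀ u → N Γ u ↦[ β ] N Γ (α ⟨$⟩ʳ u)
  N-↦ α β tf u = transport (tf u)

  PreservedByTFAut : (Fin n → Fin n → Set) → Set
  PreservedByTFAut R =
    ∀ α β → IsTFAut Γ α β → ∀ u v → R u v → R (α ⟨$⟩ʳ u) (α ⟨$⟩ʳ v)

  preserved⇒⇔ : ∀ {R} → PreservedByTFAut R →
                ∀ α β → IsTFAut Γ α β → ∀ u v → R u v ⇔ R (α ⟨$⟩ʳ u) (α ⟨$⟩ʳ v)
  preserved⇒⇔ {R} preserved α β tf u v =
    mk⇔ (preserved α β tf u v) (back ∘ preserved (flip α) (flip β) (tfAut-inverse α β tf) _ _)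
    where
    back : R (α ⟨$⟩ˡ (α ⟨$⟩ʳ u)) (α ⟨$⟩ˡ (α ⟨$⟩ʳ v)) → R u v
    back = subst₂ R (inverseˡ α) (inverseˡ α)

  BEdge-preserved : PreservedByTFAut (BEdge Γ)
  BEdge-preserved α β tf u v (u≢v , x , common) =
    u≢v ∘ Injection.injective (↔⇒↣ α) , β ⟨$⟩ʳ x , to (⇔-image N[u]∩N[v]↦ x) common
    where
    N[u]∩N[v]↦ = ↦-∩ (N-↦ α β tf u) (N-↦ α β tf v)

  Dispensable-preserved : PreservedByTFAut (Dispensable Γ)
  Dispensable-preserved α β tf u v (w , dispenses-u , dispenses-v) =
    α ⟨$⟩ʳ w , ↦-Dispenses Nu Nv Nw dispenses-u , ↦-Dispenses Nv Nu Nw dispenses-v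
    where
    Nu = N-↦ α β tf u
    Nv = N-↦ α β tf v
    Nw = N-↦ α β tf w

  tfAut⇒isAutS : ∀ α β → IsTFAut Γ α β → IsAutS Γ α
  tfAut⇒isAutS α β tf u v =
    preserved⇒⇔ BEdge-preserved α β tf u v
      ×-⇔ ¬-cong-⇔ (preserved⇒⇔ Dispensable-preserved α β tf u v)

module _ {a} {A : Set a} where

  swapIf : Bool → A × A → A × A
  swapIf false p = p
  swapIf true  p = swap p

  swapIf-not : ∀ b (p : A × A) → swapIf (not b) p ≡ swapIf b (swap p)
  swapIf-not false p = refl
  swapIf-not true  p = refl

  swapIf-diagonal : ∀ b (x : A) → swapIf b (x , x) ≡ (x , x)
  swapIf-diagonal false x = refl
  swapIf-diagonal true  x = refl

swapIf-self⇒≡ : ∀ b b′ {x y} →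
                proj₁ (swapIf b (x , y)) ≡ b → proj₂ (swapIf b′ (x , y)) ≡ b′ → x ≡ y
swapIf-self⇒≡ false false refl refl = refl
swapIf-self⇒≡ false true  refl ()
swapIf-self⇒≡ true  false refl ()
swapIf-self⇒≡ true  true  refl refl = refl

xor-transpose : ∀ a b {x} → a xor b ≡ x → a ≡ x xor b
xor-transpose false false refl = refl
xor-transpose false true  refl = refl
xor-transpose true  false refl = refl
xor-transpose true  true  refl = refl

module _ {n : ℕ} (Γ : Graph n) (c : Fin n → Bool) (bip : IsBipartition Γ c) where
  open ≡-Reasoning

  swapIf-along-walk : ∀ {a} {A : Set a} (f : Fin n → A × A) →
                      (∀ {u v} → Arc Γ u v → f v ≡ swap (f u)) →
                      ∀ {u w} → Walk Γ u w → f w ≡ swapIf (c u xor c w) (f u)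
  swapIf-along-walk f swaps {u} here = cong (λ b → swapIf b (f u)) (sym (xor-same (c u)))
  swapIf-along-walk f swaps {u} {w} (step {v = v} u→v walk) = begin
    f w                               ≡⟨ swapIf-along-walk f swaps walk ⟩
    swapIf (c v xor c w) (f v)        ≡⟨ cong (swapIf (c v xor c w)) (swaps u→v) ⟩
    swapIf (c v xor c w) (swap (f u)) ≡⟨ swapIf-not (c v xor c w) (f u) ⟨
    swapIf (not (c v xor c w)) (f u)  ≡⟨ cong (λ b → swapIf b (f u)) (not-distribˡ-xor (c v) (c w)) ⟩
    swapIf (not (c v) xor c w) (f u)  ≡⟨ cong (λ b → swapIf (b xor c w) (f u)) cu≡¬cv ⟨
    swapIf (c u xor c w) (f u)        ∎
    where
    cu≡¬cv : c u ≡ not (c v)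
    cu≡¬cv = ¬-not (bip u v u→v)

  shift : Permutation′ n → Fin n → Bool
  shift π u = c (π ⟨$⟩ʳ u) xor c u

  ShiftsColoursBy : Bool → Permutation′ n → Set
  ShiftsColoursBy x π = ∀ v → c (π ⟨$⟩ʳ v) ≡ x xor c v

  shift-preimage : ∀ π r → shift π (π ⟨$⟩ˡ r) ≡ c r xor c (π ⟨$⟩ˡ r)
  shift-preimage π r = cong (λ z → c z xor c (π ⟨$⟩ˡ r)) (inverseʳ π)

  module _ (α β : Permutation′ n) (tf : IsTFAut Γ α β) where

    shift-arc : ∀ {u v} → Arc Γ u v → shift α u ≡ shift β v
    shift-arc {u} {v} u→v = begin
      c (α ⟨$⟩ʳ u) xor c u              ≡⟨ cong₂ _xor_ (¬-not (bip _ _ (to (tf u v) u→v)))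
                                                       (¬-not (bip u v u→v)) ⟩
      not (c (β ⟨$⟩ʳ v)) xor not (c v)  ≡⟨ xor-annihilates-not (c (β ⟨$⟩ʳ v)) (c v) ⟩
      c (β ⟨$⟩ʳ v) xor c v              ∎

    shifts : Fin n → Bool × Bool
    shifts u = shift α u , shift β u

    shifts-along-walk : ∀ {u w} → Walk Γ u w → shifts w ≡ swapIf (c u xor c w) (shifts u)
    shifts-along-walk = swapIf-along-walk shifts λ u→v →
      cong₂ _,_ (shift-arc (arc-sym Γ u→v)) (sym (shift-arc u→v))

    module _ (connected : Connected Γ) (r : Fin n) where

      shifts-agree : shift α r ≡ shift β r
      shifts-agree = swapIf-self⇒≡ (c r xor c r₁) (c r xor c r₂)
        (trans (sym (cong proj₁ (shifts-along-walk (connected r r₁)))) (shift-preimage α r))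
        (trans (sym (cong proj₂ (shifts-along-walk (connected r r₂)))) (shift-preimage β r))
        where
        r₁ = α ⟨$⟩ˡ r
        r₂ = β ⟨$⟩ˡ r

      shifts-uniform : ∀ v → shifts v ≡ (shift α r , shift α r)
      shifts-uniform v = begin
        shifts v                                      ≡⟨ shifts-along-walk (connected r v) ⟩
        swapIf (c r xor c v) (shift α r , shift β r)  ≡⟨ cong (λ y → swapIf (c r xor c v) (shift α r , y))
                                                              shifts-agree ⟨
        swapIf (c r xor c v) (shift α r , shift α r)  ≡⟨ swapIf-diagonal (c r xor c v) (shift α r) ⟩
        (shift α r , shift α r)                       ∎

      colours-shifted-uniformly : ShiftsColoursBy (shift α r) α × ShiftsColoursBy (shift α r) β
      colours-shifted-uniformly = (λ v → xor-transpose _ _ (cong proj₁ (shifts-uniform v)))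
                      , (λ v → xor-transpose _ _ (cong proj₂ (shifts-uniform v)))

stabilizes-or-interchanges :
  ∀ {n} (Γ : Graph n) α β → IsTFAut Γ α β → Connected Γ →
  (c : Fin n → Bool) → IsBipartition Γ c →
  (Stabilizes c α × Stabilizes c β) ⊎ (Interchanges c α × Interchanges c β)
stabilizes-or-interchanges {zero}  Γ α β tf connected c bip = inj₁ ((λ ()) , (λ ()))
stabilizes-or-interchanges {suc n} Γ α β tf connected c bip
  with shift Γ c bip α Fin.zero | colours-shifted-uniformly Γ c bip α β tf connected Fin.zero
... | false | stabilizes   = inj₁ stabilizes
... | true  | interchanges = inj₂ interchanges

lemma3p5 : ∀ (n : ℕ) (Γ : Graph n) (α β : Permutation′ n) → IsTFAut Γ α β →
    (IsAutS Γ α × IsAutS Γ β)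
    × (Connected Γ → (c : Fin n → Bool) → IsBipartition Γ c →
        ((Stabilizes c α × Stabilizes c β) ⊎ (Interchanges c α × Interchanges c β)))
lemma3p5 n Γ α β tf =
  (tfAut⇒isAutS Γ α β tf , tfAut⇒isAutS Γ β α (tfAut-swap Γ α β tf)) ,
  stabilizes-or-interchanges Γ α β tf
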